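{- Let $m=\sqrt{2l}\,\frac{p}{q}$, where $p,q$ are positive integers and $l$ is an odd positive integer such that $2l$ can be represented as a sum of two integer squares. Then $\chi(\mathbb{Q}^{4},m)\le 4$, and hence $\chi(\mathbb{Q}^{3},m)\le 4$.
   Context: For a metric space $M$ and a real number $d>0$, the chromatic number $\chi(M,d)$ is the minimal cardinality of a set $S$ for which there is a map $f:M\to S$ with $f(x)\neq f(y)$ whenever the distance between $x$ and $y$ equals $d$. Here $\mathbb{Q}^{n}$ carries the Euclidean metric. -}

module Defs where

open import Data.Nat using (ℕ; zero; suc)
open import Data.Fin using (Fin)
import Data.Fin as Fin
open import Data.Rational using (ℚ; 0ℚ; _+_; _-_; _*_)
open import Data.Product using (Σ)
open import Relation.Binary.PropositionalEquality using (_≡_; _≢_)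

Qⁿ : ℕ → Set
Qⁿ n = Fin n → ℚ

sqDist : (n : ℕ) → Qⁿ n → Qⁿ n → ℚ
sqDist zero    x y = 0ℚ
sqDist (suc n) x y =
  (x Fin.zero - y Fin.zero) * (x Fin.zero - y Fin.zero)
  + sqDist n (λ i → x (Fin.suc i)) (λ i → y (Fin.suc i))

-- χ(M, d) ≤ k for M = ℚⁿ, where the relation "distance equals d" is
-- given as a predicate on pairs of points: there is a map into a set of
-- k elements (Fin k) separating every pair at distance d.
χ≤ : (n : ℕ) → (Qⁿ n → Qⁿ n → Set) → ℕ → Set
χ≤ n atDist k =
  Σ (Qⁿ n → Fin k) λ f → ∀ x y → atDist x y → f x ≢ f y

module Submission where

-- Points x, y are at distance m iff q²·|x − y|² = 2l·p².  Let d(r) be the units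
-- digit of the 2-adic expansion of q·r/p, and colour x ∈ ℚ⁴ by the two bits
-- d(x₁) ⊕ d(x₂) and d(x₂) ⊕ d(x₃).  For x, y at distance m, write
-- q·(x − y)/p = (N₀, …, N₃)/D over a common denominator, so ΣNᵢ² = 2l·D².  With
-- D = 2ˢ·o (o odd), a descent modulo 8 gives Nᵢ = 2ˢ·Mᵢ and ΣMᵢ² = 2l·o² ≡ 2 (mod 4),
-- so exactly two Mᵢ are odd and M₁, M₂, M₃ do not all have the same parity.  As
-- Mᵢ/o is a 2-adic integer, d(xᵢ) = d(yᵢ) ⊕ parity(Mᵢ); equal colours would force
-- the three parities to agree.  ℚ³ embeds isometrically into ℚ⁴.

module Development where
  open import Data.Bool using (Bool; true; false; T; _xor_)
  open import Data.Nat as ℕ using (ℕ; zero; suc)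
  import Data.Nat.Properties as ℕP
  open import Data.Integer as ℤ using (ℤ; +_; -[1+_]; _+_; _*_; -_; _-_; ∣_∣)
  import Data.Integer.Properties as ℤP
  open import Data.Integer.Tactic.RingSolver using (solve-∀)
  import Data.Integer.GCD as ℤG
  open import Data.Rational as ℚ using (ℚ)
  import Data.Rational.Properties as ℚP
  open import Data.Rational.Unnormalised as U using (ℚᵘ; mkℚᵘ; *≡*; _≃_)
  import Data.Rational.Unnormalised.Properties as UP
  open import Data.Product using (Σ; _×_; _,_; proj₁; proj₂)
  open import Data.Product.Properties using (,-injective)
  open import Data.Sum using (inj₁; inj₂)
  open import Data.Empty using (⊥-elim)
  open import Relation.Nullary using (¬_; yes; no)
  open import Relation.Binary.PropositionalEquality
  open import Function using (_∘_)
  open import Data.Fin using (Fin)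
  import Data.Fin as Fin
  open import Defs
  open import Induction.WellFounded using (Acc; acc)
  open import Data.Nat.Induction using (<-wellFounded)

  bit : Bool → ℤ
  bit false = + 0
  bit true  = + 1

  halve-ℕ : ∀ n → Σ Bool λ u → Σ ℤ λ h → + n ≡ bit u + + 2 * h
  halve-ℕ zero = false , + 0 , refl
  halve-ℕ (suc n) with halve-ℕ n
  ... | false , h , e = true , h , cong (_+_ (+ 1)) (trans e (ℤP.+-identityˡ (+ 2 * h)))
  ... | true  , h , e = false , h + + 1 , trans (cong (_+_ (+ 1)) e) (carry h)
    where carry : ∀ h → + 1 + (+ 1 + + 2 * h) ≡ + 0 + + 2 * (h + + 1)
          carry = solve-∀

  halve : ∀ z → Σ Bool λ u → Σ ℤ λ h → z ≡ bit u + + 2 * h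
  halve (+ n) = halve-ℕ n
  halve -[1+ n ] with halve-ℕ (suc n)
  ... | false , h , e = false , - h , trans (cong -_ e) (negate h)
    where negate : ∀ h → - (+ 0 + + 2 * h) ≡ + 0 + + 2 * (- h)
          negate = solve-∀
  ... | true  , h , e = true , - h - + 1 , trans (cong -_ e) (negate h)
    where negate : ∀ h → - (+ 1 + + 2 * h) ≡ + 1 + + 2 * (- h - + 1)
          negate = solve-∀

  parity : ℤ → Bool
  parity z = proj₁ (halve z)

  half : ℤ → ℤ
  half z = proj₁ (proj₂ (halve z))

  parity-half : ∀ z → z ≡ bit (parity z) + + 2 * half z
  parity-half z = proj₂ (proj₂ (halve z))

  Odd : ℤ → Set
  Odd z = parity z ≡ true

  Even : ℤ → Set
  Even z = parity z ≡ false

  odd-form : ∀ z → Odd z → z ≡ + 1 + + 2 * half z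
  odd-form z o = trans (parity-half z) (cong (λ u → bit u + + 2 * half z) o)

  even-form : ∀ z → Even z → z ≡ + 2 * half z
  even-form z e = trans (parity-half z) (trans (cong (λ u → bit u + + 2 * half z) e) (ℤP.+-identityˡ _))

  -- No multiple of k has absolute value strictly between 0 and k.  The two
  -- bounds are boolean tests, so for a concrete c they hold by computation.
  not-multiple : ∀ k Z c → T (0 ℕ.<ᵇ ∣ c ∣) → T (∣ c ∣ ℕ.<ᵇ k) → + k * Z ≢ c
  not-multiple k Z c pos small e with Z ℤ.≟ + 0
  ... | yes refl = subst (λ c → T (0 ℕ.<ᵇ ∣ c ∣)) (trans (sym e) (ℤP.*-zeroʳ (+ k))) pos
  ... | no Z≢0 = ℕP.<⇒≱ (ℕP.<ᵇ⇒< ∣ c ∣ k small) k≤∣c∣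
    where k≤∣c∣ : k ℕ.≤ ∣ c ∣
          k≤∣c∣ = subst (k ℕ.≤_) (trans (sym (ℤP.abs-* (+ k) Z)) (cong ∣_∣ e)) (ℕP.m≤m*n k ∣ Z ∣ {{ℤ.≢-nonZero Z≢0}})

  even≢odd : ∀ a b → + 2 * a ≢ + 1 + + 2 * b
  even≢odd a b e = not-multiple 2 (a - b) (+ 1) _ _ (trans (expand a b) (trans (cong (_- + 2 * b) e) (cancel b)))
    where expand : ∀ a b → + 2 * (a - b) ≡ + 2 * a - + 2 * b
          expand = solve-∀
          cancel : ∀ b → + 1 + + 2 * b - + 2 * b ≡ + 1
          cancel = solve-∀

  parity-unique : ∀ {z} u h → z ≡ bit u + + 2 * h → parity z ≡ u
  parity-unique {z} u h e with parity z | parity-half z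
  parity-unique false h e | false | _ = refl
  parity-unique true  h e | true  | _ = refl
  parity-unique {z} false h e | true  | s = ⊥-elim (even≢odd h (half z) (trans (sym (ℤP.+-identityˡ _)) (trans (sym e) s)))
  parity-unique {z} true  h e | false | s = ⊥-elim (even≢odd (half z) h (trans (sym (ℤP.+-identityˡ _)) (trans (sym s) e)))

  odd-* : ∀ {a b} → Odd a → Odd b → Odd (a * b)
  odd-* {a} {b} oa ob = parity-unique {a * b} true (half a + half b + + 2 * half a * half b)
    (trans (cong₂ _*_ (odd-form a oa) (odd-form b ob)) (expand (half a) (half b)))
    where expand : ∀ x y → (+ 1 + + 2 * x) * (+ 1 + + 2 * y) ≡ + 1 + + 2 * (x + y + + 2 * x * y)
          expand = solve-∀

  odd-ℕ : ∀ {l} k → l ≡ 1 ℕ.+ 2 ℕ.* k → Odd (+ l)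
  odd-ℕ k refl = parity-unique true (+ k) (trans (ℤP.pos-+ 1 (2 ℕ.* k)) (cong (_+_ (+ 1)) (ℤP.pos-* 2 k)))

  odd≢even : ∀ {z} y → Odd z → z ≢ + 2 * y
  odd≢even {z} y o e = even≢odd y (half z) (trans (sym e) (odd-form z o))

  odd≢0 : ∀ z → Odd z → z ≢ + 0
  odd≢0 z o refl with o
  ... | ()

  -- (N² − parity N)/4, see square-mod-4.
  quarter : ℤ → ℤ
  quarter N = bit (parity N) * half N + half N * half N

  square-mod-4 : ∀ N → N * N ≡ bit (parity N) + + 4 * quarter N
  square-mod-4 N = begin
      N * N                                                   ≡⟨ cong (λ v → v * v) (parity-half N) ⟩
      (u + + 2 * h) * (u + + 2 * h)                           ≡⟨ expand u h ⟩
      u * u + + 4 * (u * h + h * h)                           ≡⟨ cong (_+ + 4 * quarter N) (bit-idempotent (parity N)) ⟩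
      u + + 4 * quarter N                                     ∎
    where
    open ≡-Reasoning
    u = bit (parity N)
    h = half N
    expand : ∀ u h → (u + + 2 * h) * (u + + 2 * h) ≡ u * u + + 4 * (u * h + h * h)
    expand = solve-∀
    bit-idempotent : ∀ b → bit b * bit b ≡ bit b
    bit-idempotent false = refl
    bit-idempotent true  = refl

  -- Odd squares are ≡ 1 (mod 8): (1 + 4g)² and (3 + 4g)² expanded.
  odd-square-mod-8 : ∀ N → Odd N → Σ ℤ λ j → N * N ≡ + 1 + + 8 * j
  odd-square-mod-8 N o with parity (half N) | parity-half (half N)
  ... | false | h≡ = g * (+ 2 * g + + 1) , trans (cong (λ v → v * v) (trans (odd-form N o) (cong (λ v → + 1 + + 2 * v) h≡))) (expand g)
    where g = half (half N)
          expand : ∀ g → (+ 1 + + 2 * (+ 0 + + 2 * g)) * (+ 1 + + 2 * (+ 0 + + 2 * g)) ≡ + 1 + + 8 * (g * (+ 2 * g + + 1))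
          expand = solve-∀
  ... | true  | h≡ = (+ 1 + + 2 * g) * (+ 1 + g) , trans (cong (λ v → v * v) (trans (odd-form N o) (cong (λ v → + 1 + + 2 * v) h≡))) (expand g)
    where g = half (half N)
          expand : ∀ g → (+ 1 + + 2 * (+ 1 + + 2 * g)) * (+ 1 + + 2 * (+ 1 + + 2 * g)) ≡ + 1 + + 8 * ((+ 1 + + 2 * g) * (+ 1 + g))
          expand = solve-∀

  twice-odd-square-mod-4 : ∀ L D → Odd L → Odd D → Σ ℤ λ Z → + 2 * L * (D * D) ≡ + 4 * Z + + 2
  twice-odd-square-mod-4 L D oL oD =
    l + + 2 * d + + 4 * l * d + + 2 * d * d + + 4 * l * d * d ,
    trans (cong₂ (λ L D → + 2 * L * (D * D)) (odd-form L oL) (odd-form D oD)) (expand l d)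
    where
    l = half L
    d = half D
    expand : ∀ l d → + 2 * (+ 1 + + 2 * l) * ((+ 1 + + 2 * d) * (+ 1 + + 2 * d))
                     ≡ + 4 * (l + + 2 * d + + 4 * l * d + + 2 * d * d + + 4 * l * d * d) + + 2
    expand = solve-∀

  subtract : ∀ {u a} v → u + v ≡ a → u ≡ a - v
  subtract {u} v e = trans (add-sub u v) (cong (_- v) e)
    where add-sub : ∀ u v → u ≡ u + v - v
          add-sub = solve-∀

  sum-of-squares : ℤ → ℤ → ℤ → ℤ → ℤ
  sum-of-squares a b c d = a * a + b * b + c * c + d * d

  sum-of-squares-cong : ∀ {a b c d a′ b′ c′ d′} → a ≡ a′ → b ≡ b′ → c ≡ c′ → d ≡ d′ →
                        sum-of-squares a b c d ≡ sum-of-squares a′ b′ c′ d′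
  sum-of-squares-cong refl refl refl refl = refl

  bits : Bool → Bool → Bool → Bool → ℤ
  bits a b c d = bit a + bit b + bit c + bit d

  sum-of-squares-mod-4 : ∀ a b c d →
    sum-of-squares a b c d ≡ bits (parity a) (parity b) (parity c) (parity d) + + 4 * (quarter a + quarter b + quarter c + quarter d)
  sum-of-squares-mod-4 a b c d =
    trans (cong₂ _+_ (cong₂ _+_ (cong₂ _+_ (square-mod-4 a) (square-mod-4 b)) (square-mod-4 c)) (square-mod-4 d))
          (regroup (bit (parity a)) (bit (parity b)) (bit (parity c)) (bit (parity d)) (quarter a) (quarter b) (quarter c) (quarter d))
    where regroup : ∀ u₀ u₁ u₂ u₃ q₀ q₁ q₂ q₃ → (u₀ + + 4 * q₀) + (u₁ + + 4 * q₁) + (u₂ + + 4 * q₂) + (u₃ + + 4 * q₃)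
                                                ≡ u₀ + u₁ + u₂ + u₃ + + 4 * (q₀ + q₁ + q₂ + q₃)
          regroup = solve-∀

  bits-multiple-of-4 : ∀ a b c d Z → bits a b c d ≡ + 4 * Z → Σ Bool λ v → (a ≡ v) × (b ≡ v) × (c ≡ v) × (d ≡ v)
  bits-multiple-of-4 false false false false Z e = false , refl , refl , refl , refl
  bits-multiple-of-4 true  true  true  true  Z e = true , refl , refl , refl , refl
  bits-multiple-of-4 false false false true  Z e = ⊥-elim (not-multiple 4 Z _ _ _ (sym e))
  bits-multiple-of-4 false false true  false Z e = ⊥-elim (not-multiple 4 Z _ _ _ (sym e))
  bits-multiple-of-4 false false true  true  Z e = ⊥-elim (not-multiple 4 Z _ _ _ (sym e))
  bits-multiple-of-4 false true  false false Z e = ⊥-elim (not-multiple 4 Z _ _ _ (sym e))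
  bits-multiple-of-4 false true  false true  Z e = ⊥-elim (not-multiple 4 Z _ _ _ (sym e))
  bits-multiple-of-4 false true  true  false Z e = ⊥-elim (not-multiple 4 Z _ _ _ (sym e))
  bits-multiple-of-4 false true  true  true  Z e = ⊥-elim (not-multiple 4 Z _ _ _ (sym e))
  bits-multiple-of-4 true  false false false Z e = ⊥-elim (not-multiple 4 Z _ _ _ (sym e))
  bits-multiple-of-4 true  false false true  Z e = ⊥-elim (not-multiple 4 Z _ _ _ (sym e))
  bits-multiple-of-4 true  false true  false Z e = ⊥-elim (not-multiple 4 Z _ _ _ (sym e))
  bits-multiple-of-4 true  false true  true  Z e = ⊥-elim (not-multiple 4 Z _ _ _ (sym e))
  bits-multiple-of-4 true  true  false false Z e = ⊥-elim (not-multiple 4 Z _ _ _ (sym e))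
  bits-multiple-of-4 true  true  false true  Z e = ⊥-elim (not-multiple 4 Z _ _ _ (sym e))
  bits-multiple-of-4 true  true  true  false Z e = ⊥-elim (not-multiple 4 Z _ _ _ (sym e))

  bits-not-2-mod-4 : ∀ a b Z → bits a b b b ≢ + 4 * Z + + 2
  bits-not-2-mod-4 false false Z e = not-multiple 4 Z _ _ _ (subtract (+ 2) (sym e))
  bits-not-2-mod-4 false true  Z e = not-multiple 4 Z _ _ _ (subtract (+ 2) (sym e))
  bits-not-2-mod-4 true  false Z e = not-multiple 4 Z _ _ _ (subtract (+ 2) (sym e))
  bits-not-2-mod-4 true  true  Z e = not-multiple 4 Z _ _ _ (subtract (+ 2) (sym e))

  -- If 8 divides N₀² + N₁² + N₂² + N₃² then every Nᵢ is even: the number of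
  -- odd terms is ≡ 0 (mod 4), and four odd squares add up to 4 (mod 8).
  all-even : ∀ N₀ N₁ N₂ N₃ X → sum-of-squares N₀ N₁ N₂ N₃ ≡ + 8 * X → Even N₀ × Even N₁ × Even N₂ × Even N₃
  all-even N₀ N₁ N₂ N₃ X e with bits-multiple-of-4 (parity N₀) (parity N₁) (parity N₂) (parity N₃) (+ 2 * X - Q) odd-count≡
    where
    open ≡-Reasoning
    Q = quarter N₀ + quarter N₁ + quarter N₂ + quarter N₃
    u = bits (parity N₀) (parity N₁) (parity N₂) (parity N₃)
    odd-count≡ : u ≡ + 4 * (+ 2 * X - Q)
    odd-count≡ = begin
      u                                   ≡⟨ subtract (+ 4 * Q) (trans (sym (sum-of-squares-mod-4 N₀ N₁ N₂ N₃)) e) ⟩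
      + 8 * X - + 4 * Q                   ≡⟨ factor X Q ⟩
      + 4 * (+ 2 * X - Q)                 ∎
      where factor : ∀ X Q → + 8 * X - + 4 * Q ≡ + 4 * (+ 2 * X - Q)
            factor = solve-∀
  ... | false , e₀ , e₁ , e₂ , e₃ = e₀ , e₁ , e₂ , e₃
  ... | true  , o₀ , o₁ , o₂ , o₃
    with odd-square-mod-8 N₀ o₀ | odd-square-mod-8 N₁ o₁ | odd-square-mod-8 N₂ o₂ | odd-square-mod-8 N₃ o₃
  ... | j₀ , s₀ | j₁ , s₁ | j₂ , s₂ | j₃ , s₃ = ⊥-elim (not-multiple 8 (X - Σj) (+ 4) _ _ eight-divides-4)
    where
    open ≡-Reasoning
    Σj = j₀ + j₁ + j₂ + j₃
    eight-divides-4 : + 8 * (X - Σj) ≡ + 4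
    eight-divides-4 = begin
      + 8 * (X - Σj)                                                       ≡⟨ expand X Σj ⟩
      + 8 * X - + 8 * Σj                                                   ≡⟨ cong (_- + 8 * Σj) (sym e) ⟩
      sum-of-squares N₀ N₁ N₂ N₃ - + 8 * Σj                                ≡⟨ cong (_- + 8 * Σj) (cong₂ _+_ (cong₂ _+_ (cong₂ _+_ s₀ s₁) s₂) s₃) ⟩
      (+ 1 + + 8 * j₀) + (+ 1 + + 8 * j₁) + (+ 1 + + 8 * j₂) + (+ 1 + + 8 * j₃) - + 8 * Σj ≡⟨ collect j₀ j₁ j₂ j₃ ⟩
      + 4                                                                 ∎
      where expand : ∀ X J → + 8 * (X - J) ≡ + 8 * X - + 8 * J
            expand = solve-∀
            collect : ∀ j₀ j₁ j₂ j₃ → (+ 1 + + 8 * j₀) + (+ 1 + + 8 * j₁) + (+ 1 + + 8 * j₂) + (+ 1 + + 8 * j₃) - + 8 * (j₀ + j₁ + j₂ + j₃) ≡ + 4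
            collect = solve-∀

  -- If N₀² + N₁² + N₂² + N₃² ≡ 2 (mod 4), exactly two of the Nᵢ are odd; in
  -- particular N₁, N₂, N₃ cannot all have the same parity.
  mixed-parities : ∀ N₀ N₁ N₂ N₃ Z → sum-of-squares N₀ N₁ N₂ N₃ ≡ + 4 * Z + + 2 →
                   ¬ (parity N₁ ≡ parity N₂ × parity N₂ ≡ parity N₃)
  mixed-parities N₀ N₁ N₂ N₃ Z e (p₁₂ , p₂₃) = bits-not-2-mod-4 (parity N₀) (parity N₁) (Z - Q) count≡
    where
    open ≡-Reasoning
    Q = quarter N₀ + quarter N₁ + quarter N₂ + quarter N₃
    count≡ : bits (parity N₀) (parity N₁) (parity N₁) (parity N₁) ≡ + 4 * (Z - Q) + + 2
    count≡ = begin
      bits (parity N₀) (parity N₁) (parity N₁) (parity N₁) ≡⟨ cong₂ (bits (parity N₀) (parity N₁)) p₁₂ (trans p₁₂ p₂₃) ⟩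
      bits (parity N₀) (parity N₁) (parity N₂) (parity N₃) ≡⟨ subtract (+ 4 * Q) (trans (sym (sum-of-squares-mod-4 N₀ N₁ N₂ N₃)) e) ⟩
      + 4 * Z + + 2 - + 4 * Q                              ≡⟨ factor Z Q ⟩
      + 4 * (Z - Q) + + 2                                  ∎
      where factor : ∀ Z Q → + 4 * Z + + 2 - + 4 * Q ≡ + 4 * (Z - Q) + + 2
            factor = solve-∀

  pow2 : ℕ → ℤ
  pow2 s = + (2 ℕ.^ s)

  pow2-suc : ∀ s → pow2 (suc s) ≡ + 2 * pow2 s
  pow2-suc s = ℤP.pos-* 2 (2 ℕ.^ s)

  pow2≢0 : ∀ s → pow2 s ≢ + 0
  pow2≢0 s P≡0 = ℕ.≢-nonZero⁻¹ (2 ℕ.^ s) {{ℕP.m^n≢0 2 s}} (ℤP.+-injective P≡0)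

  double-power : ∀ {N h M} s → N ≡ + 2 * h → h ≡ pow2 s * M → N ≡ pow2 (suc s) * M
  double-power {N} {h} {M} s N≡ h≡ = begin
    N                  ≡⟨ N≡ ⟩
    + 2 * h            ≡⟨ cong (+ 2 *_) h≡ ⟩
    + 2 * (pow2 s * M) ≡⟨ sym (ℤP.*-assoc (+ 2) (pow2 s) M) ⟩
    + 2 * pow2 s * M   ≡⟨ cong (_* M) (sym (pow2-suc s)) ⟩
    pow2 (suc s) * M   ∎
    where open ≡-Reasoning

  half≢0 : ∀ z → z ≡ + 2 * half z → z ≢ + 0 → half z ≢ + 0
  half≢0 z z≡ z≢0 h≡0 = z≢0 (trans z≡ (cong (+ 2 *_) h≡0))

  half-smaller : ∀ z → z ≡ + 2 * half z → z ≢ + 0 → ∣ half z ∣ ℕ.< ∣ z ∣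
  half-smaller z z≡ z≢0 = subst (∣ h ∣ ℕ.<_) ∣z∣≡ (ℕP.m<m*n ∣ h ∣ 2 {{ℤ.≢-nonZero (half≢0 z z≡ z≢0)}} (ℕP.n<1+n 1))
    where
    h = half z
    ∣z∣≡ : ∣ h ∣ ℕ.* 2 ≡ ∣ z ∣
    ∣z∣≡ = trans (ℕP.*-comm ∣ h ∣ 2) (trans (sym (ℤP.abs-* (+ 2) h)) (cong ∣_∣ (sym z≡)))

  two-adic-split : ∀ z → z ≢ + 0 → Σ ℕ λ s → Σ ℤ λ o → Odd o × z ≡ pow2 s * o
  two-adic-split z = split z (<-wellFounded ∣ z ∣)
    where
    split : ∀ z → Acc ℕ._<_ ∣ z ∣ → z ≢ + 0 → Σ ℕ λ s → Σ ℤ λ o → Odd o × z ≡ pow2 s * o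
    split z (acc smaller) z≢0 with parity z in pz
    ... | true  = 0 , z , pz , sym (ℤP.*-identityˡ z)
    ... | false with split (half z) (smaller (half-smaller z (even-form z pz) z≢0)) (half≢0 z (even-form z pz) z≢0)
    ...   | s , o , odd , h≡ = suc s , o , odd , double-power s (even-form z pz) h≡

  -- If N₀² + … + N₃² = 2L·(2ˢ·o)², every Nᵢ is divisible by 2ˢ and the
  -- quotients Mᵢ satisfy M₀² + … + M₃² = 2L·o²: while s > 0 the sum is divisible
  -- by 8, so all Nᵢ are even and the equation can be halved.
  record Descended (s : ℕ) (N₀ N₁ N₂ N₃ L o : ℤ) : Set where
    field
      M₀ M₁ M₂ M₃ : ℤ
      N₀≡ : N₀ ≡ pow2 s * M₀
      N₁≡ : N₁ ≡ pow2 s * M₁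
      N₂≡ : N₂ ≡ pow2 s * M₂
      N₃≡ : N₃ ≡ pow2 s * M₃
      sum : sum-of-squares M₀ M₁ M₂ M₃ ≡ + 2 * L * (o * o)

  descent : ∀ s N₀ N₁ N₂ N₃ L o → sum-of-squares N₀ N₁ N₂ N₃ ≡ + 2 * L * ((pow2 s * o) * (pow2 s * o)) →
            Descended s N₀ N₁ N₂ N₃ L o
  descent zero N₀ N₁ N₂ N₃ L o e = record
    { M₀ = N₀ ; M₁ = N₁ ; M₂ = N₂ ; M₃ = N₃
    ; N₀≡ = sym (ℤP.*-identityˡ N₀) ; N₁≡ = sym (ℤP.*-identityˡ N₁)
    ; N₂≡ = sym (ℤP.*-identityˡ N₂) ; N₃≡ = sym (ℤP.*-identityˡ N₃)
    ; sum = trans e (cong (λ v → + 2 * L * (v * v)) (ℤP.*-identityˡ o)) }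
  descent (suc s) N₀ N₁ N₂ N₃ L o e = record
    { M₀ = M₀ ; M₁ = M₁ ; M₂ = M₂ ; M₃ = M₃
    ; N₀≡ = double-power s (even-form N₀ ev₀) N₀≡ ; N₁≡ = double-power s (even-form N₁ ev₁) N₁≡
    ; N₂≡ = double-power s (even-form N₂ ev₂) N₂≡ ; N₃≡ = double-power s (even-form N₃ ev₃) N₃≡
    ; sum = sum }
    where
    open ≡-Reasoning
    D = pow2 s * o
    divisible-by-8 : sum-of-squares N₀ N₁ N₂ N₃ ≡ + 8 * (L * (D * D))
    divisible-by-8 = begin
      sum-of-squares N₀ N₁ N₂ N₃                                  ≡⟨ e ⟩
      + 2 * L * ((pow2 (suc s) * o) * (pow2 (suc s) * o))         ≡⟨ cong (λ v → + 2 * L * ((v * o) * (v * o))) (pow2-suc s) ⟩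
      + 2 * L * ((+ 2 * pow2 s * o) * (+ 2 * pow2 s * o))         ≡⟨ regroup L (pow2 s) o ⟩
      + 8 * (L * (D * D))                                         ∎
      where regroup : ∀ L P o → + 2 * L * ((+ 2 * P * o) * (+ 2 * P * o)) ≡ + 8 * (L * ((P * o) * (P * o)))
            regroup = solve-∀
    evens = all-even N₀ N₁ N₂ N₃ (L * (D * D)) divisible-by-8
    ev₀ = proj₁ evens
    ev₁ = proj₁ (proj₂ evens)
    ev₂ = proj₁ (proj₂ (proj₂ evens))
    ev₃ = proj₂ (proj₂ (proj₂ evens))
    halved : sum-of-squares (half N₀) (half N₁) (half N₂) (half N₃) ≡ + 2 * L * (D * D)
    halved = ℤP.*-cancelˡ-≡ (+ 4) _ _ (begin
      + 4 * sum-of-squares (half N₀) (half N₁) (half N₂) (half N₃)   ≡⟨ scale (half N₀) (half N₁) (half N₂) (half N₃) ⟩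
      sum-of-squares (+ 2 * half N₀) (+ 2 * half N₁) (+ 2 * half N₂) (+ 2 * half N₃)
        ≡⟨ sym (sum-of-squares-cong (even-form N₀ ev₀) (even-form N₁ ev₁) (even-form N₂ ev₂) (even-form N₃ ev₃)) ⟩
      sum-of-squares N₀ N₁ N₂ N₃                                      ≡⟨ divisible-by-8 ⟩
      + 8 * (L * (D * D))                                             ≡⟨ regroup L D ⟩
      + 4 * (+ 2 * L * (D * D))                                       ∎)
      where scale : ∀ a b c d → + 4 * (a * a + b * b + c * c + d * d)
                                ≡ (+ 2 * a) * (+ 2 * a) + (+ 2 * b) * (+ 2 * b) + (+ 2 * c) * (+ 2 * c) + (+ 2 * d) * (+ 2 * d)
            scale = solve-∀
            regroup : ∀ L D → + 8 * (L * (D * D)) ≡ + 4 * (+ 2 * L * (D * D))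
            regroup = solve-∀
    open Descended (descent s (half N₀) (half N₁) (half N₂) (half N₃) L o halved)

  -- UnitsDigit a b ε states that
  --     a / b  =  t / 2ˢ + ε + 2w / o      with 0 ≤ t < 2ˢ and o odd,
  -- with denominators cleared: ε is the units digit of the 2-adic expansion
  -- of a/b, and t/2ˢ its fractional part.
  digit-numerator : ℕ → ℕ → ℤ → ℤ → Bool → ℤ
  digit-numerator s t o w ε = + t * o + bit ε * pow2 s * o + + 2 * w * pow2 s

  record UnitsDigit (a b : ℤ) (ε : Bool) : Set where
    field
      s t   : ℕ
      o w   : ℤ
      odd-o : Odd o
      t<2ˢ  : t ℕ.< 2 ℕ.^ s
      value : a * (pow2 s * o) ≡ b * digit-numerator s t o w ε

    numerator denominator : ℤ
    numerator   = digit-numerator s t o w ε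
    denominator = pow2 s * o

  -- An odd o is invertible modulo 2ᵏ: every a is ≡ o·T (mod 2ᵏ) with 0 ≤ T < 2ᵏ.
  -- The residue is lifted one binary digit at a time.
  residue : ∀ k a o → Odd o → Σ ℕ λ T → Σ ℤ λ w → T ℕ.< 2 ℕ.^ k × a ≡ o * + T + pow2 k * w
  residue zero a o _ = 0 , a , ℕP.n<1+n 0 , trivial o a
    where trivial : ∀ o a → a ≡ o * + 0 + + 1 * a
          trivial = solve-∀
  residue (suc k) a o odd-o with residue k a o odd-o
  ... | T , w , T< , a≡ with parity w in pw
  ...   | false = T , half w , ℕP.<-≤-trans T< (ℕP.m≤m+n (2 ℕ.^ k) _) , (begin
          a                                ≡⟨ a≡ ⟩
          o * + T + pow2 k * w             ≡⟨ cong (λ v → o * + T + pow2 k * v) (even-form w pw) ⟩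
          o * + T + pow2 k * (+ 2 * half w) ≡⟨ regroup o (+ T) (pow2 k) (half w) ⟩
          o * + T + + 2 * pow2 k * half w  ≡⟨ cong (λ v → o * + T + v * half w) (sym (pow2-suc k)) ⟩
          o * + T + pow2 (suc k) * half w  ∎)
    where open ≡-Reasoning
          regroup : ∀ o T P h → o * T + P * (+ 2 * h) ≡ o * T + + 2 * P * h
          regroup = solve-∀
  ...   | true  = T ℕ.+ 2 ℕ.^ k , half w - half o , ℕP.+-mono-<-≤ T< (ℕP.m≤m+n (2 ℕ.^ k) 0) , (begin
          a                                                       ≡⟨ a≡ ⟩
          o * + T + pow2 k * w                                    ≡⟨ cong₂ (λ o w → o * + T + pow2 k * w) (odd-form o odd-o) (odd-form w pw) ⟩
          o′ * + T + pow2 k * (+ 1 + + 2 * half w)                ≡⟨ regroup (half o) (+ T) (pow2 k) (half w) ⟩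
          o′ * (+ T + pow2 k) + + 2 * pow2 k * (half w - half o)  ≡⟨ cong₂ (λ v P → v * (+ T + pow2 k) + P * (half w - half o)) (sym (odd-form o odd-o)) (sym (pow2-suc k)) ⟩
          o * (+ T + pow2 k) + pow2 (suc k) * (half w - half o)   ≡⟨ cong (λ v → o * v + pow2 (suc k) * (half w - half o)) (sym (ℤP.pos-+ T (2 ℕ.^ k))) ⟩
          o * + (T ℕ.+ 2 ℕ.^ k) + pow2 (suc k) * (half w - half o) ∎)
    where open ≡-Reasoning
          o′ = + 1 + + 2 * half o
          regroup : ∀ g T P h → (+ 1 + + 2 * g) * T + P * (+ 1 + + 2 * h) ≡ (+ 1 + + 2 * g) * (T + P) + + 2 * P * (h - g)
          regroup = solve-∀

  clear : ∀ {a b K N} → b ≡ K → a ≡ N → a * K ≡ b * N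
  clear {a} {b} {K} {N} refl a≡ = trans (cong (_* b) a≡) (ℤP.*-comm N b)

  -- Every fraction a/b has a units digit.  Writing b = 2ˢ·o, the residue T of
  -- a/o modulo 2ˢ⁺¹ gives the digit ε = [T ≥ 2ˢ] and the fractional part T mod 2ˢ.
  units-digit : ∀ a b → b ≢ + 0 → Σ Bool (UnitsDigit a b)
  units-digit a b b≢0 with two-adic-split b b≢0
  ... | s , o , odd-o , b≡ with residue (suc s) a o odd-o
  ...   | T , w , T< , a≡ with T ℕ.<? 2 ℕ.^ s
  ...     | yes T<2ˢ = false , record { s = s ; t = T ; o = o ; w = w ; odd-o = odd-o ; t<2ˢ = T<2ˢ
                                      ; value = clear b≡ (trans a≡ (trans (cong (λ P → o * + T + P * w) (pow2-suc s)) (regroup o (+ T) (pow2 s) w))) }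
    where regroup : ∀ o T P w → o * T + (+ 2 * P) * w ≡ T * o + + 0 * P * o + + 2 * w * P
          regroup = solve-∀
  ...     | no T≮2ˢ = true , record { s = s ; t = t ; o = o ; w = w ; odd-o = odd-o ; t<2ˢ = t<2ˢ
                                    ; value = clear b≡ (trans a≡ (trans (cong₂ (λ v P → o * v + P * w) (sym T≡′) (pow2-suc s)) (regroup o (+ t) (pow2 s) w))) }
    where
    t = T ℕ.∸ 2 ℕ.^ s
    T≡ : t ℕ.+ 2 ℕ.^ s ≡ T
    T≡ = ℕP.m∸n+n≡m (ℕP.≮⇒≥ T≮2ˢ)
    T≡′ : + t + pow2 s ≡ + T
    T≡′ = cong +_ T≡
    t<2ˢ : t ℕ.< 2 ℕ.^ s
    t<2ˢ = ℕP.+-cancelʳ-< _ _ (2 ℕ.^ s) (subst (ℕ._< 2 ℕ.^ s ℕ.+ 2 ℕ.^ s) (sym T≡) (subst (T ℕ.<_) (cong (2 ℕ.^ s ℕ.+_) (ℕP.+-identityʳ _)) T<))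
    regroup : ∀ o t P w → o * (t + P) + (+ 2 * P) * w ≡ t * o + + 1 * P * o + + 2 * w * P
    regroup = solve-∀

  -- An odd multiple of δ that is divisible by 2ⁿ forces 2ⁿ ∣ δ, so |δ| < 2ⁿ gives δ = 0.
  odd-multiple-of-power : ∀ n δ o u → Odd o → o * δ ≡ pow2 n * u → ∣ δ ∣ ℕ.< 2 ℕ.^ n → δ ≡ + 0
  odd-multiple-of-power zero δ o u _ _ ∣δ∣<1 = ℤP.∣i∣≡0⇒i≡0 (ℕP.n<1⇒n≡0 ∣δ∣<1)
  odd-multiple-of-power (suc n) δ o u odd-o oδ≡ ∣δ∣< with parity δ in pδ
  ... | true  = ⊥-elim (odd≢even (pow2 n * u) (odd-* {o} {δ} odd-o pδ) (trans oδ≡ (trans (cong (_* u) (pow2-suc n)) (ℤP.*-assoc (+ 2) (pow2 n) u))))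
  ... | false = trans δ≡ (cong (+ 2 *_) (odd-multiple-of-power n (half δ) o u odd-o halved ∣half∣<))
    where
    δ≡ : δ ≡ + 2 * half δ
    δ≡ = even-form δ pδ
    halved : o * half δ ≡ pow2 n * u
    halved = ℤP.*-cancelˡ-≡ (+ 2) _ _ (begin
      + 2 * (o * half δ)  ≡⟨ ℤP.*-comm (+ 2) (o * half δ) ⟩
      o * half δ * + 2    ≡⟨ ℤP.*-assoc o (half δ) (+ 2) ⟩
      o * (half δ * + 2)  ≡⟨ cong (o *_) (trans (ℤP.*-comm (half δ) (+ 2)) (sym δ≡)) ⟩
      o * δ               ≡⟨ oδ≡ ⟩
      pow2 (suc n) * u    ≡⟨ cong (_* u) (pow2-suc n) ⟩
      + 2 * pow2 n * u    ≡⟨ ℤP.*-assoc (+ 2) (pow2 n) u ⟩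
      + 2 * (pow2 n * u)  ∎)
      where open ≡-Reasoning
    ∣half∣< : ∣ half δ ∣ ℕ.< 2 ℕ.^ n
    ∣half∣< = ℕP.*-cancelˡ-< 2 _ _ (subst (ℕ._< 2 ℕ.* 2 ℕ.^ n) (trans (cong ∣_∣ δ≡) (ℤP.abs-* (+ 2) (half δ))) ∣δ∣<)

  distance-bound : ∀ {A B N} → A ℕ.< N → B ℕ.< N → ∣ + A - + B ∣ ℕ.< N
  distance-bound {A} {B} {N} A<N B<N rewrite ℤP.m-n≡m⊖n A B with A ℕ.≤? B
  ... | yes A≤B = subst (ℕ._< N) (sym (ℤP.∣⊖∣-≤ A≤B)) (ℕP.≤-<-trans (ℕP.m∸n≤m B A) B<N)
  ... | no A≰B  = subst (ℕ._< N) (sym (cong ∣_∣ (ℤP.⊖-≥ (ℕP.<⇒≤ (ℕP.≰⇒> A≰B))))) (ℕP.≤-<-trans (ℕP.m∸n≤m A B) A<N)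

  fractional-parts-close : ∀ t s t′ s′ → t ℕ.< 2 ℕ.^ s → t′ ℕ.< 2 ℕ.^ s′ → ∣ + t * pow2 s′ - + t′ * pow2 s ∣ ℕ.< 2 ℕ.^ (s ℕ.+ s′)
  fractional-parts-close t s t′ s′ t< t′< =
    subst (λ x → ∣ x ∣ ℕ.< 2 ℕ.^ (s ℕ.+ s′)) (cong₂ _-_ (ℤP.pos-* t (2 ℕ.^ s′)) (ℤP.pos-* t′ (2 ℕ.^ s)))
      (distance-bound (scaled t s s′ t<) (subst (t′ ℕ.* 2 ℕ.^ s ℕ.<_) (cong (2 ℕ.^_) (ℕP.+-comm s′ s)) (scaled t′ s′ s t′<)))
    where scaled : ∀ t s s′ → t ℕ.< 2 ℕ.^ s → t ℕ.* 2 ℕ.^ s′ ℕ.< 2 ℕ.^ (s ℕ.+ s′)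
          scaled t s s′ t< = subst (t ℕ.* 2 ℕ.^ s′ ℕ.<_) (sym (ℕP.^-distribˡ-+-* 2 s s′)) (ℕP.*-monoˡ-< (2 ℕ.^ s′) {{ℕP.m^n≢0 2 s′}} t<)

  bit-difference : ∀ ε ε′ {o} y → Odd o → o * (bit ε - bit ε′) ≡ + 2 * y → ε ≡ ε′
  bit-difference false false y _ _ = refl
  bit-difference true  true  y _ _ = refl
  bit-difference true  false {o} y odd-o e = ⊥-elim (odd≢even y odd-o (trans (sym (ℤP.*-identityʳ o)) e))
  bit-difference false true  {o} y odd-o e = ⊥-elim (odd≢even (- y) odd-o (trans (negate o) (trans (cong -_ e) (ℤP.neg-distribʳ-* (+ 2) y))))
    where negate : ∀ o → o ≡ - (o * (+ 0 - + 1))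
          negate = solve-∀

  -- Two expansions of one value have the same units digit: if
  --   t/2ˢ + ε + 2w/o = t′/2ˢ′ + ε′ + 2w′/o′,
  -- clearing denominators gives o·o′·δ = 2ˢ⁺ˢ′·(−v) for δ = t·2ˢ′ − t′·2ˢ and
  -- v = o·o′·(ε − ε′) + 2(w·o′ − w′·o).  As |δ| < 2ˢ⁺ˢ′, δ = 0, hence v = 0.
  digits-agree : ∀ {a b a′ b′ ε ε′} (d : UnitsDigit a b ε) (d′ : UnitsDigit a′ b′ ε′) →
                 UnitsDigit.numerator d * UnitsDigit.denominator d′ ≡ UnitsDigit.numerator d′ * UnitsDigit.denominator d →
                 ε ≡ ε′
  digits-agree {ε = ε} {ε′} d d′ cross = bit-difference ε ε′ {o * o′} (w′ * o - w * o′) (odd-* {o} {o′} odd-o odd-o′) bits-differ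
    where
    open ≡-Reasoning
    open UnitsDigit d
    open UnitsDigit d′ using () renaming (s to s′; t to t′; o to o′; w to w′; odd-o to odd-o′; t<2ˢ to t′<2ˢ′)
    P  = pow2 s
    P′ = pow2 s′
    δ = + t * P′ - + t′ * P
    v = (o * o′) * (bit ε - bit ε′) + + 2 * (w * o′ - w′ * o)
    PP′≡ : P * P′ ≡ pow2 (s ℕ.+ s′)
    PP′≡ = trans (sym (ℤP.pos-* (2 ℕ.^ s) (2 ℕ.^ s′))) (cong +_ (sym (ℕP.^-distribˡ-+-* 2 s s′)))
    cleared : (o * o′) * δ ≡ pow2 (s ℕ.+ s′) * (- v)
    cleared = begin
      (o * o′) * δ                                                   ≡⟨ expand o o′ (+ t) (+ t′) P P′ (bit ε) (bit ε′) w w′ ⟩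
      (digit-numerator s t o w ε * (P′ * o′) - digit-numerator s′ t′ o′ w′ ε′ * (P * o)) + (P * P′) * (- v)
                                                                     ≡⟨ cong (λ x → x + (P * P′) * (- v)) (ℤP.i≡j⇒i-j≡0 cross) ⟩
      + 0 + (P * P′) * (- v)                                         ≡⟨ ℤP.+-identityˡ _ ⟩
      (P * P′) * (- v)                                               ≡⟨ cong (_* (- v)) PP′≡ ⟩
      pow2 (s ℕ.+ s′) * (- v)                                        ∎
      where expand : ∀ o o′ t t′ P P′ e e′ w w′ →
                     (o * o′) * (t * P′ - t′ * P)
                     ≡ ((t * o + e * P * o + + 2 * w * P) * (P′ * o′) - (t′ * o′ + e′ * P′ * o′ + + 2 * w′ * P′) * (P * o))
                       + (P * P′) * (- ((o * o′) * (e - e′) + + 2 * (w * o′ - w′ * o)))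
            expand = solve-∀
    δ≡0 : δ ≡ + 0
    δ≡0 = odd-multiple-of-power (s ℕ.+ s′) δ (o * o′) (- v) (odd-* {o} {o′} odd-o odd-o′) cleared (fractional-parts-close t s t′ s′ t<2ˢ t′<2ˢ′)
    -v≡0 : - v ≡ + 0
    -v≡0 = ℤP.*-cancelˡ-≡ (pow2 (s ℕ.+ s′)) (- v) (+ 0) {{ℤ.≢-nonZero (pow2≢0 (s ℕ.+ s′))}}
             (trans (sym cleared) (trans (cong ((o * o′) *_) δ≡0) (trans (ℤP.*-zeroʳ (o * o′)) (sym (ℤP.*-zeroʳ (pow2 (s ℕ.+ s′)))))))
    bits-differ : (o * o′) * (bit ε - bit ε′) ≡ + 2 * (w′ * o - w * o′)
    bits-differ = begin
      (o * o′) * (bit ε - bit ε′)                        ≡⟨ isolate o o′ (bit ε) (bit ε′) w w′ ⟩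
      + 2 * (w′ * o - w * o′) - (- v)                    ≡⟨ cong (λ x → + 2 * (w′ * o - w * o′) - x) -v≡0 ⟩
      + 2 * (w′ * o - w * o′) - + 0                      ≡⟨ ℤP.+-identityʳ _ ⟩
      + 2 * (w′ * o - w * o′)                            ∎
      where isolate : ∀ o o′ e e′ w w′ → (o * o′) * (e - e′) ≡ + 2 * (w′ * o - w * o′) - (- ((o * o′) * (e - e′) + + 2 * (w * o′ - w′ * o)))
            isolate = solve-∀

  product≢0 : ∀ {i j} → i ≢ + 0 → j ≢ + 0 → i * j ≢ + 0
  product≢0 {i} i≢0 j≢0 ij≡0 with ℤP.i*j≡0⇒i≡0∨j≡0 i ij≡0
  ... | inj₁ i≡0 = i≢0 i≡0
  ... | inj₂ j≡0 = j≢0 j≡0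

  cancelʳ : ∀ i j k → k ≢ + 0 → i * k ≡ j * k → i ≡ j
  cancelʳ i j k k≢0 = ℤP.*-cancelʳ-≡ i j k {{ℤ.≢-nonZero k≢0}}

  same-value : ∀ {a b a′ b′ ε ε′} (d : UnitsDigit a b ε) (d′ : UnitsDigit a′ b′ ε′) →
               a * b′ ≡ a′ * b → b ≢ + 0 → b′ ≢ + 0 →
               UnitsDigit.numerator d * UnitsDigit.denominator d′ ≡ UnitsDigit.numerator d′ * UnitsDigit.denominator d
  same-value {a} {b} {a′} {b′} d d′ cross b≢0 b′≢0 = cancelʳ (X * K′) (X′ * K) (b * b′) (product≢0 b≢0 b′≢0) (begin
      X * K′ * (b * b′)     ≡⟨ regroup₁ X K′ b b′ ⟩
      (b * X) * (b′ * K′)   ≡⟨ cong (_* (b′ * K′)) (sym (UnitsDigit.value d)) ⟩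
      (a * K) * (b′ * K′)   ≡⟨ regroup₂ a K b′ K′ ⟩
      (a * b′) * (K * K′)   ≡⟨ cong (_* (K * K′)) cross ⟩
      (a′ * b) * (K * K′)   ≡⟨ regroup₃ a′ b K K′ ⟩
      (a′ * K′) * (b * K)   ≡⟨ cong (_* (b * K)) (UnitsDigit.value d′) ⟩
      (b′ * X′) * (b * K)   ≡⟨ regroup₄ b′ X′ b K ⟩
      X′ * K * (b * b′)     ∎)
    where
    open ≡-Reasoning
    X  = UnitsDigit.numerator d
    K  = UnitsDigit.denominator d
    X′ = UnitsDigit.numerator d′
    K′ = UnitsDigit.denominator d′
    regroup₁ : ∀ X K′ b b′ → X * K′ * (b * b′) ≡ (b * X) * (b′ * K′)
    regroup₁ = solve-∀
    regroup₂ : ∀ a K b′ K′ → (a * K) * (b′ * K′) ≡ (a * b′) * (K * K′)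
    regroup₂ = solve-∀
    regroup₃ : ∀ a′ b K K′ → (a′ * b) * (K * K′) ≡ (a′ * K′) * (b * K)
    regroup₃ = solve-∀
    regroup₄ : ∀ b′ X′ b K → (b′ * X′) * (b * K) ≡ X′ * K * (b * b′)
    regroup₄ = solve-∀

  units-digit-unique : ∀ {a b a′ b′ ε ε′} → UnitsDigit a b ε → UnitsDigit a′ b′ ε′ →
                       a * b′ ≡ a′ * b → b ≢ + 0 → b′ ≢ + 0 → ε ≡ ε′
  units-digit-unique d d′ cross b≢0 b′≢0 = digits-agree d d′ (same-value d d′ cross b≢0 b′≢0)

  bit-xor : ∀ a b → bit (a xor b) ≡ bit a + bit b - + 2 * bit a * bit b
  bit-xor false false = refl
  bit-xor false true  = refl
  bit-xor true  false = refl
  bit-xor true  true  = refl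

  -- Adding M/D with D odd changes the units digit by the parity of M: M/D is a
  -- 2-adic integer ≡ M (mod 2), and the fractional part t/2ˢ is untouched.
  units-digit-shift : ∀ {a b ε} → UnitsDigit a b ε → ∀ M D → Odd D →
                      UnitsDigit (a * D + M * b) (b * D) (ε xor parity M)
  units-digit-shift {a} {b} {ε} d M D odd-D = record
    { s = s ; t = t ; o = o * D ; w = w′ ; odd-o = odd-* {o} {D} odd-o odd-D ; t<2ˢ = t<2ˢ ; value = value′ }
    where
    open ≡-Reasoning
    open UnitsDigit d
    e = bit ε
    u = bit (parity M)
    m = half M
    δ = half D
    w′ = - (o * u * δ) + o * (+ 1 + + 2 * δ) * e * u + w * (+ 1 + + 2 * δ) + m * o
    value′ : (a * D + M * b) * (pow2 s * (o * D)) ≡ (b * D) * digit-numerator s t (o * D) w′ (ε xor parity M)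
    value′ = begin
      (a * D + M * b) * (pow2 s * (o * D))
        ≡⟨ distribute a D M b (pow2 s) o ⟩
      D * D * (a * (pow2 s * o)) + M * b * pow2 s * o * D
        ≡⟨ cong (λ x → D * D * x + M * b * pow2 s * o * D) value ⟩
      D * D * (b * digit-numerator s t o w ε) + M * b * pow2 s * o * D
        ≡⟨ cong₂ (λ D M → D * D * (b * digit-numerator s t o w ε) + M * b * pow2 s * o * D) (odd-form D odd-D) (parity-half M) ⟩
      _ ≡⟨ collect b (+ t) o e u w m δ (pow2 s) ⟩
      (b * (+ 1 + + 2 * δ)) * (+ t * (o * (+ 1 + + 2 * δ)) + (e + u - + 2 * e * u) * pow2 s * (o * (+ 1 + + 2 * δ)) + + 2 * w′ * pow2 s)
        ≡⟨ sym (cong₂ (λ D E → (b * D) * (+ t * (o * D) + E * pow2 s * (o * D) + + 2 * w′ * pow2 s)) (odd-form D odd-D) (bit-xor ε (parity M))) ⟩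
      (b * D) * digit-numerator s t (o * D) w′ (ε xor parity M) ∎
      where
      distribute : ∀ a D M b P o → (a * D + M * b) * (P * (o * D)) ≡ D * D * (a * (P * o)) + M * b * P * o * D
      distribute = solve-∀
      collect : ∀ b t o e u w m δ P →
        (+ 1 + + 2 * δ) * (+ 1 + + 2 * δ) * (b * (t * o + e * P * o + + 2 * w * P)) + (u + + 2 * m) * b * P * o * (+ 1 + + 2 * δ)
        ≡ (b * (+ 1 + + 2 * δ)) * (t * (o * (+ 1 + + 2 * δ)) + (e + u - + 2 * e * u) * P * (o * (+ 1 + + 2 * δ))
            + + 2 * (- (o * u * δ) + o * (+ 1 + + 2 * δ) * e * u + w * (+ 1 + + 2 * δ) + m * o) * P)
      collect = solve-∀

  -- Fractionᵘ U a b says that the unnormalised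
  -- rational U equals a/b (b ≠ 0, not necessarily reduced or positive).  On ℚᵘ,
  -- sums and products act on numerators and denominators directly, and
  -- toℚᵘ is a ring homomorphism, so this is how rational equations become
  -- integer equations.
  record Fractionᵘ (U : ℚᵘ) (a b : ℤ) : Set where
    constructor fractionᵘ
    field cross : U.↥ U * b ≡ a * U.↧ U

  fractionᵘ-≃ : ∀ {U V a b} → U ≃ V → Fractionᵘ U a b → Fractionᵘ V a b
  fractionᵘ-≃ {mkℚᵘ nu du} {V@(mkℚᵘ nv dv)} {a} {b} (*≡* U≃V) (fractionᵘ h) = fractionᵘ
    (ℤP.*-cancelʳ-≡ (nv * b) (a * U.↧ V) (+ suc du) (begin
      nv * b * + suc du      ≡⟨ regroup nv b (+ suc du) ⟩
      nv * + suc du * b      ≡⟨ cong (_* b) (sym U≃V) ⟩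
      nu * + suc dv * b      ≡⟨ regroup nu (+ suc dv) b ⟩
      nu * b * + suc dv      ≡⟨ cong (_* + suc dv) h ⟩
      a * + suc du * + suc dv ≡⟨ regroup a (+ suc du) (+ suc dv) ⟩
      a * + suc dv * + suc du ∎))
    where
    open ≡-Reasoning
    regroup : ∀ x y z → x * y * z ≡ x * z * y
    regroup = solve-∀

  fractionᵘ-+ : ∀ {U V a b c d} → Fractionᵘ U a b → Fractionᵘ V c d → Fractionᵘ (U U.+ V) (a * d + c * b) (b * d)
  fractionᵘ-+ {mkℚᵘ nu du} {mkℚᵘ nv dv} {a} {b} {c} {d} (fractionᵘ hu) (fractionᵘ hv) = fractionᵘ
    (trans (spread nu nv (+ suc du) (+ suc dv) b d)
      (trans (cong₂ (λ x y → x * (+ suc dv * d) + y * (+ suc du * b)) hu hv) (collect a b c d (+ suc du) (+ suc dv))))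
    where
    spread : ∀ nu nv du dv b d → (nu * dv + nv * du) * (b * d) ≡ (nu * b) * (dv * d) + (nv * d) * (du * b)
    spread = solve-∀
    collect : ∀ a b c d du dv → (a * du) * (dv * d) + (c * dv) * (du * b) ≡ (a * d + c * b) * (du * dv)
    collect = solve-∀

  fractionᵘ-* : ∀ {U V a b c d} → Fractionᵘ U a b → Fractionᵘ V c d → Fractionᵘ (U U.* V) (a * c) (b * d)
  fractionᵘ-* {mkℚᵘ nu du} {mkℚᵘ nv dv} {a} {b} {c} {d} (fractionᵘ hu) (fractionᵘ hv) = fractionᵘ
    (trans (regroup nu nv b d) (trans (cong₂ _*_ hu hv) (regroup a (+ suc du) c (+ suc dv))))
    where
    regroup : ∀ w x y z → (w * x) * (y * z) ≡ (w * y) * (x * z)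
    regroup = solve-∀

  fractionᵘ-neg : ∀ {U a b} → Fractionᵘ U a b → Fractionᵘ (U.- U) (- a) b
  fractionᵘ-neg {mkℚᵘ nu du} {a} {b} (fractionᵘ h) =
    fractionᵘ (trans (sym (ℤP.neg-distribˡ-* nu b)) (trans (cong -_ h) (ℤP.neg-distribˡ-* a _)))

  Fraction : ℚ → ℤ → ℤ → Set
  Fraction r = Fractionᵘ (ℚ.toℚᵘ r)

  fraction-canonical : ∀ r → Fraction r (ℚ.↥ r) (ℚ.↧ r)
  fraction-canonical (ℚ.mkℚ n d c) = fractionᵘ refl

  fraction-+ : ∀ {r s a b c d} → Fraction r a b → Fraction s c d → Fraction (r ℚ.+ s) (a * d + c * b) (b * d)
  fraction-+ {r} {s} hr hs = fractionᵘ-≃ (UP.≃-sym (ℚP.toℚᵘ-homo-+ r s)) (fractionᵘ-+ hr hs)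

  fraction-* : ∀ {r s a b c d} → Fraction r a b → Fraction s c d → Fraction (r ℚ.* s) (a * c) (b * d)
  fraction-* {r} {s} hr hs = fractionᵘ-≃ (UP.≃-sym (ℚP.toℚᵘ-homo-* r s)) (fractionᵘ-* hr hs)

  fraction-neg : ∀ {r a b} → Fraction r a b → Fraction (ℚ.- r) (- a) b
  fraction-neg {r} h = fractionᵘ-≃ (UP.≃-sym (ℚP.toℚᵘ-homo‿- r)) (fractionᵘ-neg h)

  fraction-integer : ∀ i → Fraction (i ℚ./ 1) i (+ 1)
  fraction-integer i = fraction (i ℚ./ 1) (begin
      ℚ.↥ (i ℚ./ 1) * + 1                               ≡⟨ cong (ℚ.↥ (i ℚ./ 1) *_) (sym (ℚP.↧-/ i 1)) ⟩
      ℚ.↥ (i ℚ./ 1) * (ℚ.↧ (i ℚ./ 1) * ℤG.gcd i (+ 1))  ≡⟨ regroup (ℚ.↥ (i ℚ./ 1)) (ℚ.↧ (i ℚ./ 1)) (ℤG.gcd i (+ 1)) ⟩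
      ℚ.↥ (i ℚ./ 1) * ℤG.gcd i (+ 1) * ℚ.↧ (i ℚ./ 1)    ≡⟨ cong (_* ℚ.↧ (i ℚ./ 1)) (ℚP.↥-/ i 1) ⟩
      i * ℚ.↧ (i ℚ./ 1)                                 ∎)
    where
    open ≡-Reasoning
    fraction : ∀ r → ℚ.↥ r * + 1 ≡ i * ℚ.↧ r → Fraction r i (+ 1)
    fraction (ℚ.mkℚ n d c) h = fractionᵘ h
    regroup : ∀ a b g → a * (b * g) ≡ a * g * b
    regroup = solve-∀

  fraction-unique : ∀ {r a b c d} → Fraction r a b → Fraction r c d → a * d ≡ c * b
  fraction-unique {r@(ℚ.mkℚ n den-1 _)} {a} {b} {c} {d} (fractionᵘ h₁) (fractionᵘ h₂) =
    ℤP.*-cancelʳ-≡ (a * d) (c * b) (+ suc den-1) (begin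
      a * d * + suc den-1    ≡⟨ regroup a d (+ suc den-1) ⟩
      a * + suc den-1 * d    ≡⟨ cong (_* d) (sym h₁) ⟩
      n * b * d              ≡⟨ regroup n b d ⟩
      n * d * b              ≡⟨ cong (_* b) h₂ ⟩
      c * + suc den-1 * b    ≡⟨ regroup c (+ suc den-1) b ⟩
      c * b * + suc den-1    ∎)
    where
    open ≡-Reasoning
    regroup : ∀ x y z → x * y * z ≡ x * z * y
    regroup = solve-∀

  gap gap-denominator : ℚ → ℚ → ℤ
  gap x y = ℚ.↥ x * ℚ.↧ y + (- ℚ.↥ y) * ℚ.↧ x
  gap-denominator x y = ℚ.↧ x * ℚ.↧ y

  sqDist-numerator sqDist-denominator : (n : ℕ) → Qⁿ n → Qⁿ n → ℤ
  sqDist-numerator zero x y = + 0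
  sqDist-numerator (suc n) x y =
    (gap (x Fin.zero) (y Fin.zero) * gap (x Fin.zero) (y Fin.zero)) * sqDist-denominator n (x ∘ Fin.suc) (y ∘ Fin.suc)
    + sqDist-numerator n (x ∘ Fin.suc) (y ∘ Fin.suc) * (gap-denominator (x Fin.zero) (y Fin.zero) * gap-denominator (x Fin.zero) (y Fin.zero))
  sqDist-denominator zero x y = + 1
  sqDist-denominator (suc n) x y =
    (gap-denominator (x Fin.zero) (y Fin.zero) * gap-denominator (x Fin.zero) (y Fin.zero)) * sqDist-denominator n (x ∘ Fin.suc) (y ∘ Fin.suc)

  fraction-sqDist : ∀ n x y → Fraction (sqDist n x y) (sqDist-numerator n x y) (sqDist-denominator n x y)
  fraction-sqDist zero x y = fractionᵘ refl
  fraction-sqDist (suc n) x y = fraction-+ (fraction-* difference difference) (fraction-sqDist n (x ∘ Fin.suc) (y ∘ Fin.suc))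
    where difference = fraction-+ (fraction-canonical (x Fin.zero)) (fraction-neg (fraction-canonical (y Fin.zero)))

  code : Bool → Bool → Fin 4
  code false false = Fin.zero
  code false true  = Fin.suc Fin.zero
  code true  false = Fin.suc (Fin.suc Fin.zero)
  code true  true  = Fin.suc (Fin.suc (Fin.suc Fin.zero))

  decode : Fin 4 → Bool × Bool
  decode Fin.zero                            = false , false
  decode (Fin.suc Fin.zero)                  = false , true
  decode (Fin.suc (Fin.suc Fin.zero))        = true , false
  decode (Fin.suc (Fin.suc (Fin.suc _)))     = true , true

  decode-code : ∀ a b → decode (code a b) ≡ (a , b)
  decode-code false false = refl
  decode-code false true  = refl
  decode-code true  false = refl
  decode-code true  true  = refl

  code-injective : ∀ {a b c d} → code a b ≡ code c d → a ≡ c × b ≡ d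
  code-injective {a} {b} {c} {d} e = ,-injective (trans (sym (decode-code a b)) (trans (cong decode e) (decode-code c d)))

  xor-cancel : ∀ a b u v → (a xor u) xor (b xor v) ≡ a xor b → u ≡ v
  xor-cancel a b false false _ = refl
  xor-cancel a b true  true  _ = refl
  xor-cancel false false false true  ()
  xor-cancel false true  false true  ()
  xor-cancel true  false false true  ()
  xor-cancel true  true  false true  ()
  xor-cancel false false true  false ()
  xor-cancel false true  true  false ()
  xor-cancel true  false true  false ()
  xor-cancel true  true  true  false ()

  common-factor : ∀ a b R M s o → R ≢ + 0 → a * R ≡ pow2 s * M → b * R ≡ pow2 s * o → a * o ≡ M * b
  common-factor a b R M s o R≢0 aR≡ bR≡ = cancelʳ (a * o) (M * b) (R * pow2 s) (product≢0 R≢0 (pow2≢0 s)) (begin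
      a * o * (R * pow2 s)      ≡⟨ regroup₁ a o R (pow2 s) ⟩
      (a * R) * (o * pow2 s)    ≡⟨ cong (_* (o * pow2 s)) aR≡ ⟩
      pow2 s * M * (o * pow2 s) ≡⟨ regroup₂ (pow2 s) M o ⟩
      M * (pow2 s * o) * pow2 s ≡⟨ cong (λ v → M * v * pow2 s) (sym bR≡) ⟩
      M * (b * R) * pow2 s      ≡⟨ regroup₃ M b R (pow2 s) ⟩
      M * b * (R * pow2 s)      ∎)
    where
    open ≡-Reasoning
    regroup₁ : ∀ a o R P → a * o * (R * P) ≡ (a * R) * (o * P)
    regroup₁ = solve-∀
    regroup₂ : ∀ P M o → P * M * (o * P) ≡ M * (P * o) * P
    regroup₂ = solve-∀
    regroup₃ : ∀ M b R P → M * (b * R) * P ≡ M * b * (R * P)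
    regroup₃ = solve-∀

  module Colouring (p′ q l : ℕ) (odd-l : Odd (+ l)) where
    open ≡-Reasoning

    p : ℕ
    p = suc p′

    Forbidden : (n : ℕ) → Qⁿ n → Qⁿ n → Set
    Forbidden n x y = sqDist n x y ℚ.* (+ (q ℕ.* q) ℚ./ 1) ≡ (+ (2 ℕ.* l ℕ.* (p ℕ.* p)) ℚ./ 1)

    digit : ℚ → Bool
    digit r = proj₁ (units-digit (ℚ.↥ r * + q) (ℚ.↧ r * + p) (λ ()))

    digit-spec : ∀ r → UnitsDigit (ℚ.↥ r * + q) (ℚ.↧ r * + p) (digit r)
    digit-spec r = proj₂ (units-digit (ℚ.↥ r * + q) (ℚ.↧ r * + p) (λ ()))

    digit-step : ∀ x y M o → Odd o → + q * gap x y * o ≡ M * (+ p * gap-denominator x y) →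
                 digit x ≡ digit y xor parity M
    digit-step x y M o odd-o h =
      sym (units-digit-unique (units-digit-shift (digit-spec y) M o odd-o) (digit-spec x) cross
                              (product≢0 {ℚ.↧ y * + p} (λ ()) (odd≢0 o odd-o)) (λ ()))
      where
      a = ℚ.↥ x
      b = ℚ.↧ x
      c = ℚ.↥ y
      d = ℚ.↧ y
      cross : (c * + q * o + M * (d * + p)) * (b * + p) ≡ (a * + q) * (d * + p * o)
      cross = begin
        (c * + q * o + M * (d * + p)) * (b * + p)             ≡⟨ expand c d b (+ q) (+ p) o M ⟩
        c * + q * o * (b * + p) + + p * (M * (+ p * (b * d))) ≡⟨ cong (λ v → c * + q * o * (b * + p) + + p * v) (sym h) ⟩
        c * + q * o * (b * + p) + + p * (+ q * (a * d + (- c) * b) * o) ≡⟨ collect a b c d (+ q) (+ p) o ⟩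
        (a * + q) * (d * + p * o)                             ∎
        where expand : ∀ c d b q p o M → (c * q * o + M * (d * p)) * (b * p) ≡ c * q * o * (b * p) + p * (M * (p * (b * d)))
              expand = solve-∀
              collect : ∀ a b c d q p o → c * q * o * (b * p) + p * (q * (a * d + (- c) * b) * o) ≡ (a * q) * (d * p * o)
              collect = solve-∀

    i₀ i₁ i₂ i₃ : Fin 4
    i₀ = Fin.zero
    i₁ = Fin.suc Fin.zero
    i₂ = Fin.suc (Fin.suc Fin.zero)
    i₃ = Fin.suc (Fin.suc (Fin.suc Fin.zero))

    -- Over the common denominator D = p·f₀·f₁·f₂·f₃ (fᵢ the denominator of xᵢ − yᵢ),
    -- coordinate i of q·(x − y)/p has numerator Nᵢ = q·eᵢ·(product of the other fⱼ).
    f : Qⁿ 4 → Qⁿ 4 → Fin 4 → ℤ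
    f x y i = gap-denominator (x i) (y i)

    cofactor : Qⁿ 4 → Qⁿ 4 → Fin 4 → ℤ
    cofactor x y Fin.zero                             = f x y i₁ * f x y i₂ * f x y i₃
    cofactor x y (Fin.suc Fin.zero)                   = f x y i₀ * f x y i₂ * f x y i₃
    cofactor x y (Fin.suc (Fin.suc Fin.zero))         = f x y i₀ * f x y i₁ * f x y i₃
    cofactor x y (Fin.suc (Fin.suc (Fin.suc Fin.zero))) = f x y i₀ * f x y i₁ * f x y i₂

    common-denominator : Qⁿ 4 → Qⁿ 4 → ℤ
    common-denominator x y = + p * (f x y i₀ * f x y i₁ * f x y i₂ * f x y i₃)

    N : Qⁿ 4 → Qⁿ 4 → Fin 4 → ℤ
    N x y i = + q * gap (x i) (y i) * cofactor x y i

    -- All denominators are products of positive integers.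
    cofactor≢0 : ∀ x y i → cofactor x y i ≢ + 0
    cofactor≢0 x y Fin.zero                               ()
    cofactor≢0 x y (Fin.suc Fin.zero)                     ()
    cofactor≢0 x y (Fin.suc (Fin.suc Fin.zero))           ()
    cofactor≢0 x y (Fin.suc (Fin.suc (Fin.suc Fin.zero))) ()

    common-denominator-factors : ∀ x y i → + p * f x y i * cofactor x y i ≡ common-denominator x y
    common-denominator-factors x y Fin.zero                               = reorder₀ (+ p) (f x y i₀) (f x y i₁) (f x y i₂) (f x y i₃)
      where reorder₀ : ∀ p f₀ f₁ f₂ f₃ → p * f₀ * (f₁ * f₂ * f₃) ≡ p * (f₀ * f₁ * f₂ * f₃)
            reorder₀ = solve-∀
    common-denominator-factors x y (Fin.suc Fin.zero)                     = reorder₁ (+ p) (f x y i₀) (f x y i₁) (f x y i₂) (f x y i₃)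
      where reorder₁ : ∀ p f₀ f₁ f₂ f₃ → p * f₁ * (f₀ * f₂ * f₃) ≡ p * (f₀ * f₁ * f₂ * f₃)
            reorder₁ = solve-∀
    common-denominator-factors x y (Fin.suc (Fin.suc Fin.zero))           = reorder₂ (+ p) (f x y i₀) (f x y i₁) (f x y i₂) (f x y i₃)
      where reorder₂ : ∀ p f₀ f₁ f₂ f₃ → p * f₂ * (f₀ * f₁ * f₃) ≡ p * (f₀ * f₁ * f₂ * f₃)
            reorder₂ = solve-∀
    common-denominator-factors x y (Fin.suc (Fin.suc (Fin.suc Fin.zero))) = reorder₃ (+ p) (f x y i₀) (f x y i₁) (f x y i₂) (f x y i₃)
      where reorder₃ : ∀ p f₀ f₁ f₂ f₃ → p * f₃ * (f₀ * f₁ * f₂) ≡ p * (f₀ * f₁ * f₂ * f₃)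
            reorder₃ = solve-∀

    cleared-equation : ∀ x y → Forbidden 4 x y →
      sum-of-squares (N x y i₀) (N x y i₁) (N x y i₂) (N x y i₃) ≡ + 2 * + l * (common-denominator x y * common-denominator x y)
    cleared-equation x y forbidden = begin
      sum-of-squares (N x y i₀) (N x y i₁) (N x y i₂) (N x y i₃)
        ≡⟨ expand-numerator e₀ e₁ e₂ e₃ f₀ f₁ f₂ f₃ (+ q) ⟩
      sqDist-numerator 4 x y * (+ q * + q) * + 1
        ≡⟨ cong (λ v → sqDist-numerator 4 x y * v * + 1) (sym (ℤP.pos-* q q)) ⟩
      sqDist-numerator 4 x y * + (q ℕ.* q) * + 1
        ≡⟨ integer-equation ⟩
      + (2 ℕ.* l ℕ.* (p ℕ.* p)) * (sqDist-denominator 4 x y * + 1)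
        ≡⟨ cong (_* (sqDist-denominator 4 x y * + 1)) (trans (ℤP.pos-* (2 ℕ.* l) (p ℕ.* p)) (cong₂ _*_ (ℤP.pos-* 2 l) (ℤP.pos-* p p))) ⟩
      + 2 * + l * (+ p * + p) * (sqDist-denominator 4 x y * + 1)
        ≡⟨ expand-denominator f₀ f₁ f₂ f₃ (+ l) (+ p) ⟩
      + 2 * + l * (common-denominator x y * common-denominator x y) ∎
      where
      e₀ = gap (x i₀) (y i₀)
      e₁ = gap (x i₁) (y i₁)
      e₂ = gap (x i₂) (y i₂)
      e₃ = gap (x i₃) (y i₃)
      f₀ = f x y i₀
      f₁ = f x y i₁
      f₂ = f x y i₂
      f₃ = f x y i₃
      integer-equation : sqDist-numerator 4 x y * + (q ℕ.* q) * + 1 ≡ + (2 ℕ.* l ℕ.* (p ℕ.* p)) * (sqDist-denominator 4 x y * + 1)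
      integer-equation = fraction-unique
        (subst (λ r → Fraction r (sqDist-numerator 4 x y * + (q ℕ.* q)) (sqDist-denominator 4 x y * + 1)) forbidden (fraction-* (fraction-sqDist 4 x y) (fraction-integer (+ (q ℕ.* q)))))
        (fraction-integer (+ (2 ℕ.* l ℕ.* (p ℕ.* p))))
      expand-numerator : ∀ e₀ e₁ e₂ e₃ f₀ f₁ f₂ f₃ q →
        (q * e₀ * (f₁ * f₂ * f₃)) * (q * e₀ * (f₁ * f₂ * f₃)) + (q * e₁ * (f₀ * f₂ * f₃)) * (q * e₁ * (f₀ * f₂ * f₃))
        + (q * e₂ * (f₀ * f₁ * f₃)) * (q * e₂ * (f₀ * f₁ * f₃)) + (q * e₃ * (f₀ * f₁ * f₂)) * (q * e₃ * (f₀ * f₁ * f₂))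
        ≡ ((e₀ * e₀) * ((f₁ * f₁) * ((f₂ * f₂) * ((f₃ * f₃) * + 1)))
           + ((e₁ * e₁) * ((f₂ * f₂) * ((f₃ * f₃) * + 1))
              + ((e₂ * e₂) * ((f₃ * f₃) * + 1) + ((e₃ * e₃) * + 1 + + 0 * (f₃ * f₃)) * (f₂ * f₂)) * (f₁ * f₁)) * (f₀ * f₀))
          * (q * q) * + 1
      expand-numerator = solve-∀
      expand-denominator : ∀ f₀ f₁ f₂ f₃ l p →
        + 2 * l * (p * p) * (((f₀ * f₀) * ((f₁ * f₁) * ((f₂ * f₂) * ((f₃ * f₃) * + 1)))) * + 1)
        ≡ + 2 * l * ((p * (f₀ * f₁ * f₂ * f₃)) * (p * (f₀ * f₁ * f₂ * f₃)))
      expand-denominator = solve-∀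

    colour : Qⁿ 4 → Fin 4
    colour x = code (digit (x i₁) xor digit (x i₂)) (digit (x i₂) xor digit (x i₃))

    -- By descent,
    -- q·(x − y)/p = (M₀, M₁, M₂, M₃)/o with o odd and M₀² + … + M₃² = 2l·o² ≡ 2 (mod 4),
    -- so the parities of M₁, M₂, M₃ are not all equal.  But the digits of xᵢ and yᵢ
    -- differ by the parity of Mᵢ, so equal colours would make them all equal.
    colour-separates : ∀ x y → Forbidden 4 x y → colour x ≢ colour y
    colour-separates x y forbidden same-colour with two-adic-split (common-denominator x y) (λ ())
    ... | s , o , odd-o , D≡ = mixed-parities M₀ M₁ M₂ M₃ Z (trans sum 2lo²≡) (parity₁≡₂ , parity₂≡₃)
      where
      open Descended (descent s (N x y i₀) (N x y i₁) (N x y i₂) (N x y i₃) (+ l) o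
                        (trans (cleared-equation x y forbidden) (cong (λ D → + 2 * + l * (D * D)) D≡)))
      Z = proj₁ (twice-odd-square-mod-4 (+ l) o odd-l odd-o)
      2lo²≡ = proj₂ (twice-odd-square-mod-4 (+ l) o odd-l odd-o)
      step : ∀ i M → N x y i ≡ pow2 s * M → digit (x i) ≡ digit (y i) xor parity M
      step i M N≡ = digit-step (x i) (y i) M o odd-o
        (common-factor (+ q * gap (x i) (y i)) (+ p * f x y i) (cofactor x y i) M s o (cofactor≢0 x y i) N≡
                       (trans (common-denominator-factors x y i) D≡))
      colours = code-injective same-colour
      parity₁≡₂ : parity M₁ ≡ parity M₂
      parity₁≡₂ = xor-cancel (digit (y i₁)) (digit (y i₂)) (parity M₁) (parity M₂)
                    (trans (cong₂ _xor_ (sym (step i₁ M₁ N₁≡)) (sym (step i₂ M₂ N₂≡))) (proj₁ colours))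
      parity₂≡₃ : parity M₂ ≡ parity M₃
      parity₂≡₃ = xor-cancel (digit (y i₂)) (digit (y i₃)) (parity M₂) (parity M₃)
                    (trans (cong₂ _xor_ (sym (step i₂ M₂ N₂≡)) (sym (step i₃ M₃ N₃≡))) (proj₂ colours))

    embed : Qⁿ 3 → Qⁿ 4
    embed x Fin.zero    = ℚ.0ℚ
    embed x (Fin.suc i) = x i

    embed-forbidden : ∀ x y → Forbidden 3 x y → Forbidden 4 (embed x) (embed y)
    embed-forbidden x y = subst (λ d → d ℚ.* (+ (q ℕ.* q) ℚ./ 1) ≡ (+ (2 ℕ.* l ℕ.* (p ℕ.* p)) ℚ./ 1))
                                (sym (ℚP.+-identityˡ (sqDist 3 x y)))

open import Defs
open import Data.Nat using (ℕ; _+_; _*_; _<_)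
open import Data.Integer using (ℤ)
import Data.Integer as ℤ
open import Data.Rational using (ℚ)
import Data.Rational as ℚ
open import Data.Product using (Σ; _×_)
open import Relation.Binary.PropositionalEquality using (_≡_)
open import Data.Nat using (suc; s≤s; z≤n)
open import Data.Product using (_,_)
open import Function using (_∘_)

-- Colour ℚ⁴ by Colouring.colour and ℚ³ through its embedding into ℚ⁴.
mainTheorem11 :
    (p q l : ℕ) → 0 < p → 0 < q →
    Σ ℕ (λ k → l ≡ 1 + 2 * k) →
    Σ ℤ (λ a → Σ ℤ (λ b → ℤ.+ (2 * l) ≡ a ℤ.* a ℤ.+ b ℤ.* b)) →
    χ≤ 4 (λ x y → sqDist 4 x y ℚ.* (ℤ.+ (q * q) ℚ./ 1) ≡ (ℤ.+ (2 * l * (p * p)) ℚ./ 1)) 4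
    × χ≤ 3 (λ x y → sqDist 3 x y ℚ.* (ℤ.+ (q * q) ℚ./ 1) ≡ (ℤ.+ (2 * l * (p * p)) ℚ./ 1)) 4
mainTheorem11 (suc p′) q l (s≤s z≤n) _ (k , l≡1+2k) _ =
  (colour , colour-separates) ,
  (colour ∘ embed , λ x y → colour-separates (embed x) (embed y) ∘ embed-forbidden x y)
  where open Development
        open Colouring p′ q l (odd-ℕ k l≡1+2k)
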